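{- Let $r\ge3$ be an integer and $G$ an $r$-large complete bipartite graph. Then $\sigma(G,3,r)\ge\lfloor r/2\rfloor$.
   Context: A complete bipartite graph is $r$-large if each of its two parts has at least $2r$ vertices. The game $\mathrm{RS}(G,m,r,s)$ is played on a finite graph $G$ by $r$ revolutionaries and $s$ spies. First each revolutionary occupies a vertex, then each spy occupies a vertex (several players may share a vertex). In each subsequent round, each revolutionary may move to an adjacent vertex or stay put, and then each spy may move to an adjacent vertex or stay put; all positions are known to all players. The revolutionaries win if at the end of some round (the initial placement counts as a round) some vertex holds at least $m$ revolutionaries and no spy; the spies win if this never happens. $\sigma(G,m,r)$ denotes the minimum $s$ such that the spies have a winning strategy in $\mathrm{RS}(G,m,r,s)$. Standing assumption: $|V(G)|\ge r-m+1\ge\lfloor r/m\rfloor\ge1$. -}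

module Defs where

open import Data.Nat using (ℕ; zero; suc; _*_; _≤_; _<_)
open import Data.Fin using (Fin)
open import Data.Sum using (_⊎_; inj₁; inj₂)
open import Data.Product using (Σ; ∃; _×_; _,_; proj₁; proj₂)
open import Data.List using (List; []; _∷_)
open import Data.Empty using (⊥)
open import Data.Unit using (⊤)
open import Relation.Binary.PropositionalEquality using (_≡_)
open import Relation.Nullary using (¬_)
open import Function.Definitions using (Injective)

KV : ℕ → ℕ → Set
KV a b = Fin a ⊎ Fin b

KAdj : (a b : ℕ) → KV a b → KV a b → Set
KAdj a b (inj₁ _) (inj₁ _) = ⊥
KAdj a b (inj₁ _) (inj₂ _) = ⊤
KAdj a b (inj₂ _) (inj₁ _) = ⊤
KAdj a b (inj₂ _) (inj₂ _) = ⊥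

module RS (V : Set) (Adj : V → V → Set) (m r s : ℕ) where

  RConf : Set
  RConf = Fin r → V

  SConf : Set
  SConf = Fin s → V

  Pos : Set
  Pos = RConf × SConf

  Step : V → V → Set
  Step x y = (x ≡ y) ⊎ Adj x y

  Moves : {k : ℕ} → (Fin k → V) → (Fin k → V) → Set
  Moves c c' = ∀ i → Step (c i) (c' i)

  RevWinsAt : Pos → Set
  RevWinsAt (R , S) =
    Σ V λ v → Σ (Fin m → Fin r) λ f →
      Injective _≡_ _≡_ f × (∀ k → R (f k) ≡ v) × (∀ j → ¬ (S j ≡ v))

  -- Strategies may depend on the whole history (list of earlier
  -- positions, most recent first) and the current position.
  record RevStrategy : Set where
    field
      place : RConf
      move  : (past : List Pos) (R : RConf) (S : SConf) → Σ RConf (Moves R)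

  record SpyStrategy : Set where
    field
      place   : RConf → SConf
      respond : (past : List Pos) (R : RConf) (S : SConf)
                (R' : RConf) → Moves R R' → Σ SConf (Moves S)

  play : RevStrategy → SpyStrategy → ℕ → List Pos × Pos
  play τ σ zero = [] , (RevStrategy.place τ , SpyStrategy.place σ (RevStrategy.place τ))
  play τ σ (suc n) with play τ σ n
  ... | past , (R , S) with RevStrategy.move τ past R S
  ... | R' , p = ((R , S) ∷ past) , (R' , proj₁ (SpyStrategy.respond σ past R S R' p))

  SpiesWin : Set
  SpiesWin = Σ SpyStrategy λ σ →
    ∀ (τ : RevStrategy) (n : ℕ) → ¬ RevWinsAt (proj₂ (play τ σ n))

RLarge : ℕ → ℕ → ℕ → Set
RLarge r a b = (2 * r ≤ a) × (2 * r ≤ b)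

-- σ(G, m, r) ≥ k : no number s < k of spies has a winning strategy
-- (σ is the least s for which the spies win)
σ≥ : (V : Set) (Adj : V → V → Set) (m r k : ℕ) → Set
σ≥ V Adj m r k = ∀ s → s < k → ¬ RS.SpiesWin V Adj m r s

module Submission where

-- Put k = ⌊r/2⌋ and suppose s < k spies had a winning strategy σ. Split k into
-- e = ⌊k/2⌋ and t = ⌈k/2⌉. The revolutionaries start on distinct vertices of side A.
-- Since σ is a fixed deterministic answer to the history, we may run it against
-- several revolutionary strategies with the same opening and combine what it must do:
--  * a threat: in round 1 all revolutionaries attack t free vertices of side B in
--    triples; saving them needs t spies that start on side A;
--  * the real round 1: 2e revolutionaries on spy-free vertices (holders) stay, and
--    2t others (crossers) move to partner vertices on side B; a holder's vertex that
--    becomes occupied needs a spy that started on side B;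
--  * two alternative second rounds: pairs of crossers return to free holder vertices
--    (strike A), or pairs of holders join free crosser vertices (strike B); blocking
--    them needs spies on side B, resp. side A, after round 1.
-- Three pairs of these families consist of spies distinguished by their side at a
-- common time, so each pair has at most s members; the three bounds contradict s < k.

open import Defs
open import Data.Nat using (ℕ; zero; suc; _+_; _*_; _∸_; _≤_; _<_; z≤n; s≤s; _⊓_; _/_; ⌊_/2⌋; ⌈_/2⌉; _<?_; _≤?_)
open import Data.Nat.Properties
open import Data.Nat.DivMod using (m/n*n≤m)
open import Data.Fin using (Fin; inject≤)
open import Data.Fin.Properties using (any?; inject≤-injective; injective⇒≤) renaming (_≟_ to _≟ᶠ_)
open import Data.Sum using (inj₁; inj₂)
open import Data.Sum.Properties using (≡-dec; inj₁-injective; inj₂-injective)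
open import Data.Product using (Σ; ∃-syntax; _×_; _,_; proj₁; proj₂)
open import Data.Maybe using (Maybe; just; nothing)
open import Data.List using (List; []; _∷_; [_]; length; filter; take; drop; map; _++_; lookup; allFin)
open import Data.List.Properties using (take++drop≡id; length-take; length-drop; length-++; length-map; length-tabulate)
open import Data.List.Relation.Unary.All as All using (All; []; _∷_)
open import Data.List.Relation.Unary.All.Properties using () renaming (++⁺ to All-++⁺)
open import Data.List.Relation.Unary.AllPairs using ([]; _∷_)
open import Data.List.Relation.Unary.Any using (here; there)
open import Data.List.Relation.Unary.Unique.Propositional using (Unique)
import Data.List.Relation.Unary.Unique.Propositional.Properties as Unique
open import Data.List.Membership.Propositional using (_∈_; _∉_)
open import Data.List.Membership.Propositional.Properties using (∈-++⁺ˡ; ∈-++⁺ʳ; ∈-++⁻; ∈-lookup; ∈-filter⁻; ∈-map⁻)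
open import Data.Empty using (⊥; ⊥-elim)
open import Data.Unit using (⊤; tt)
open import Relation.Nullary using (¬_; Dec; yes; no; ¬?)
open import Relation.Unary using (Decidable)
open import Relation.Binary using (DecidableEquality)
open import Relation.Binary.PropositionalEquality using (_≡_; _≢_; refl; sym; trans; cong; cong₂; subst; subst₂; module ≡-Reasoning)
open import Function using (_∘_)

module _ {A : Set} where

  length-filter-split : {P : A → Set} (P? : Decidable P) (xs : List A) →
    length (filter P? xs) + length (filter (¬? ∘ P?) xs) ≡ length xs
  length-filter-split P? [] = refl
  length-filter-split P? (x ∷ xs) with P? x
  ... | yes _ = cong suc (length-filter-split P? xs)
  ... | no _  = trans (+-suc _ _) (cong suc (length-filter-split P? xs))

  length-take-≤ : ∀ n (xs : List A) → n ≤ length xs → length (take n xs) ≡ n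
  length-take-≤ n xs n≤ = trans (length-take n xs) (m≤n⇒m⊓n≡m n≤)

  length-targets : ∀ {B : Set} (f : A → B) n (xs : List A) → length (map f (take n xs)) ≡ n ⊓ length xs
  length-targets f n xs = trans (length-map f (take n xs)) (length-take n xs)

  ∈-take : ∀ n {x} {xs : List A} → x ∈ take n xs → x ∈ xs
  ∈-take n {xs = xs} x∈ = subst (_ ∈_) (take++drop≡id n xs) (∈-++⁺ˡ x∈)

  ∈-drop : ∀ n {x} {xs : List A} → x ∈ drop n xs → x ∈ xs
  ∈-drop n {xs = xs} x∈ = subst (_ ∈_) (take++drop≡id n xs) (∈-++⁺ʳ (take n xs) x∈)

  take-drop-disjoint : ∀ n {xs : List A} → Unique xs → ∀ {x} → x ∈ take n xs → x ∉ drop n xs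
  take-drop-disjoint zero    {xs}     u        ()
  take-drop-disjoint (suc n) {[]}     u        ()
  take-drop-disjoint (suc n) {y ∷ xs} (y∉ ∷ u) (here refl) x∈ = All.lookup y∉ (∈-drop n x∈) refl
  take-drop-disjoint (suc n) {y ∷ xs} (y∉ ∷ u) (there x∈) = take-drop-disjoint n u x∈

  lookup-injective : {xs : List A} → Unique xs → ∀ {i j} → lookup xs i ≡ lookup xs j → i ≡ j
  lookup-injective (x∉ ∷ u) {Fin.zero}  {Fin.zero}  eq = refl
  lookup-injective (x∉ ∷ u) {Fin.zero}  {Fin.suc j} eq = ⊥-elim (All.lookup x∉ (∈-lookup j) eq)
  lookup-injective (x∉ ∷ u) {Fin.suc i} {Fin.zero}  eq = ⊥-elim (All.lookup x∉ (∈-lookup i) (sym eq))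
  lookup-injective (x∉ ∷ u) {Fin.suc i} {Fin.suc j} eq = cong Fin.suc (lookup-injective u eq)

unique-length≤ : ∀ {n} {js : List (Fin n)} → Unique js → length js ≤ n
unique-length≤ u = injective⇒≤ (lookup-injective u)

module GraphGame (V : Set) (Adj : V → V → Set) (_≟_ : DecidableEquality V)
                 (adj? : ∀ x y → Dec (Adj x y)) (m r s : ℕ) where

  open RS V Adj m r s public
  open import Data.List.Membership.DecPropositional (_≟ᶠ_ {r}) using (_∈?_)

  Occupied : SConf → V → Set
  Occupied S v = ∃[ j ] S j ≡ v

  occupied? : ∀ S v → Dec (Occupied S v)
  occupied? S v = any? (λ j → S j ≟ v)

  guarded : ∀ {R S v} (is : List (Fin r)) → Unique is → m ≤ length is →
            All (λ i → R i ≡ v) is → ¬ RevWinsAt (R , S) → Occupied S v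
  guarded {R} {S} {v} is u m≤ at ¬win with occupied? S v
  ... | yes occ  = occ
  ... | no  free = ⊥-elim (¬win (v , gang , gang-injective , gang-at , λ j e → free (j , e)))
    where
    gang : Fin m → Fin r
    gang k = lookup is (inject≤ k m≤)
    gang-injective : ∀ {k l} → gang k ≡ gang l → k ≡ l
    gang-injective eq = inject≤-injective m≤ m≤ _ _ (lookup-injective u eq)
    gang-at : ∀ k → R (gang k) ≡ v
    gang-at k = All.lookup at (∈-lookup (inject≤ k m≤))

  arrival : ∀ {S S'} → Moves S S' → ∀ {v} → ¬ Occupied S v → Occupied S' v →
            ∃[ j ] S' j ≡ v × Adj (S j) v
  arrival mv free (j , refl) with mv j
  ... | inj₁ stayed = ⊥-elim (free (j , stayed))
  ... | inj₂ moved  = j , refl , moved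

  spies-at : (Q : Fin s → Set) (S : SConf) (vs : List V) → Unique vs →
             (∀ {v} → v ∈ vs → ∃[ j ] S j ≡ v × Q j) →
             ∃[ js ] Unique js × length js ≡ length vs × All Q js × All (λ j → S j ∈ vs) js
  spies-at Q S [] _ _ = [] , [] , refl , [] , []
  spies-at Q S (v ∷ vs) (v∉ ∷ u) at with spies-at Q S vs u (at ∘ there) | at (here refl)
  ... | js , ujs , len , qs , js-at | j , Sj≡v , qj =
    j ∷ js , All.map j-new js-at ∷ ujs , cong suc len , qj ∷ qs , here Sj≡v ∷ All.map there js-at
    where
    j-new : ∀ {j'} → S j' ∈ vs → j ≢ j'
    j-new Sj'∈ refl = All.lookup v∉ (subst (_∈ vs) Sj≡v Sj'∈) refl

  spy-bound : (Q : Fin s → Set) {S S' : SConf} {xs ys : List V} → Unique xs → Unique ys →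
              (∀ {v} → v ∈ xs → ∃[ j ] S j ≡ v × Q j) →
              (∀ {v} → v ∈ ys → ∃[ j ] S' j ≡ v × ¬ Q j) → length xs + length ys ≤ s
  spy-bound Q {S} {S'} {xs} {ys} ux uy at-xs at-ys
    with spies-at Q S xs ux at-xs | spies-at (¬_ ∘ Q) S' ys uy at-ys
  ... | is , uis , len-is , q-is , _ | js , ujs , len-js , ¬q-js , _ =
    subst (_≤ s) (trans (length-++ is) (cong₂ _+_ len-is len-js))
      (unique-length≤ (Unique.++⁺ uis ujs λ (j∈is , j∈js) → All.lookup ¬q-js j∈js (All.lookup q-is j∈is)))

  occupied-bound : (S : SConf) {vs : List V} → Unique vs → (∀ {v} → v ∈ vs → Occupied S v) → length vs ≤ s
  occupied-bound S {vs} u occ with spies-at (λ _ → ⊤) S vs u (λ v∈ → let (j , Sj≡v) = occ v∈ in j , Sj≡v , tt)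
  ... | js , ujs , len , _ = subst (_≤ s) len (unique-length≤ ujs)

  Plan : Set
  Plan = Fin r → Maybe V

  toward : V → Maybe V → V
  toward x nothing = x
  toward x (just y) with adj? x y
  ... | yes _ = y
  ... | no  _ = x

  toward-step : ∀ x p → Step x (toward x p)
  toward-step x nothing = inj₁ refl
  toward-step x (just y) with adj? x y
  ... | yes xy = inj₂ xy
  ... | no  _  = inj₁ refl

  toward-arrives : ∀ {x y p} → p ≡ just y → Adj x y → toward x p ≡ y
  toward-arrives {x} {y} refl xy with adj? x y
  ... | yes _  = refl
  ... | no ¬xy = ⊥-elim (¬xy xy)

  execute : Plan → RConf → RConf
  execute p R i = toward (R i) (p i)

  planned : RConf → (List Pos → SConf → Plan) → RevStrategy
  planned R₀ plan = record
    { place = R₀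
    ; move  = λ past R S → execute (plan past S) R , λ i → toward-step (R i) (plan past S i) }

  groups : ℕ → List (Fin r) → List V → Plan
  groups g ms []       i = nothing
  groups g ms (v ∷ vs) i with i ∈? take g ms
  ... | yes _ = just v
  ... | no  _ = groups g (drop g ms) vs i

  groups-outside : ∀ g ms vs {i} → i ∉ ms → groups g ms vs i ≡ nothing
  groups-outside g ms []       i∉ = refl
  groups-outside g ms (v ∷ vs) {i} i∉ with i ∈? take g ms
  ... | yes i∈ = ⊥-elim (i∉ (∈-take g i∈))
  ... | no  _  = groups-outside g (drop g ms) vs (i∉ ∘ ∈-drop g)

  groups-assign : ∀ g ms vs {v} → Unique ms → g * length vs ≤ length ms → v ∈ vs →
    ∃[ js ] Unique js × length js ≡ g × All (_∈ ms) js × All (λ i → groups g ms vs i ≡ just v) js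
  groups-assign g ms (w ∷ vs) u enough (here refl) =
    take g ms , Unique.take⁺ g u , length-take-≤ g ms g≤ , All.tabulate (∈-take g) , All.tabulate first
    where
    g≤ : g ≤ length ms
    g≤ = ≤-trans (m≤m+n g _) (subst (_≤ length ms) (*-suc g (length vs)) enough)
    first : ∀ {i} → i ∈ take g ms → groups g ms (w ∷ vs) i ≡ just w
    first {i} i∈ with i ∈? take g ms
    ... | yes _  = refl
    ... | no  i∉ = ⊥-elim (i∉ i∈)
  groups-assign g ms (w ∷ vs) {v} u enough (there v∈)
    with groups-assign g (drop g ms) vs (Unique.drop⁺ g u) enough′ v∈
    where
    enough′ : g * length vs ≤ length (drop g ms)
    enough′ = subst₂ _≤_ (m+n∸m≡n g _) (sym (length-drop g ms))
                (∸-monoˡ-≤ g (subst (_≤ length ms) (*-suc g (length vs)) enough))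
  ... | js , ujs , len , js⊆ , js→v =
    js , ujs , len , All.map (∈-drop g) js⊆ , All.zipWith later (js⊆ , js→v)
    where
    later : ∀ {i} → i ∈ drop g ms × groups g (drop g ms) vs i ≡ just v → groups g ms (w ∷ vs) i ≡ just v
    later {i} (i∈ , eq) with i ∈? take g ms
    ... | yes i∈′ = ⊥-elim (take-drop-disjoint g u i∈′ i∈)
    ... | no  _   = eq

  attack : ∀ g ms vs {R S S'} → Unique ms → g * length vs ≤ length ms →
           (∀ {i v} → i ∈ ms → v ∈ vs → Adj (R i) v) →
           Moves S S' → ¬ RevWinsAt (execute (groups g ms vs) R , S') →
           ∀ {v} → v ∈ vs → ¬ Occupied S v →
           (rs : List (Fin r)) → Unique rs → m ≤ length rs + g →
           All (λ i → R i ≡ v) rs → All (_∉ ms) rs →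
           ∃[ j ] S' j ≡ v × Adj (S j) v
  attack g ms vs {R} uniq enough reach mv ¬win {v} v∈ free rs urs crowd home outside
    with groups-assign g ms vs uniq enough v∈
  ... | js , ujs , len , js⊆ , js→v =
    arrival mv free (guarded (rs ++ js) (Unique.++⁺ urs ujs disjoint) size
                      (All-++⁺ (All.map stays outside-home) (All.zipWith arrives (js⊆ , js→v))) ¬win)
    where
    disjoint : ∀ {i} → ¬ (i ∈ rs × i ∈ js)
    disjoint (i∈rs , i∈js) = All.lookup outside i∈rs (All.lookup js⊆ i∈js)
    size : m ≤ length (rs ++ js)
    size = subst (m ≤_) (sym (trans (length-++ rs) (cong (length rs +_) len))) crowd
    outside-home : All (λ i → i ∉ ms × R i ≡ v) rs
    outside-home = All.zip (outside , home)
    stays : ∀ {i} → i ∉ ms × R i ≡ v → execute (groups g ms vs) R i ≡ v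
    stays {i} (i∉ , Ri≡v) = trans (cong (toward (R i)) (groups-outside g ms vs i∉)) Ri≡v
    arrives : ∀ {i} → i ∈ ms × groups g ms vs i ≡ just v → execute (groups g ms vs) R i ≡ v
    arrives (i∈ , plan) = toward-arrives plan (reach i∈ v∈)

module Bipartite (a b : ℕ) where

  _≟V_ : DecidableEquality (KV a b)
  _≟V_ = ≡-dec _≟ᶠ_ _≟ᶠ_

  adj? : ∀ x y → Dec (KAdj a b x y)
  adj? (inj₁ _) (inj₁ _) = no λ ()
  adj? (inj₁ _) (inj₂ _) = yes tt
  adj? (inj₂ _) (inj₁ _) = yes tt
  adj? (inj₂ _) (inj₂ _) = no λ ()

  OnA : KV a b → Set
  OnA (inj₁ _) = ⊤
  OnA (inj₂ _) = ⊥

  into-A : ∀ {x u} → KAdj a b x (inj₁ u) → ¬ OnA x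
  into-A {inj₂ _} _ ()

  into-B : ∀ {x w} → KAdj a b x (inj₂ w) → OnA x
  into-B {inj₁ _} _ = tt

trade : ∀ {x y o f} → x + y ≤ o + f → o ≤ y → x ≤ f
trade {x} {y} {o} {f} le o≤y =
  +-cancelʳ-≤ y x f (≤-trans le (≤-trans (+-monoˡ-≤ f o≤y) (≤-reflexive (+-comm y f))))

double : ∀ n → 2 * n ≡ n + n
double n = cong (n +_) (+-identityʳ n)

halves : ∀ k → 2 * ⌊ k /2⌋ + 2 * ⌈ k /2⌉ ≡ 2 * k
halves k = trans (sym (*-distribˡ-+ 2 ⌊ k /2⌋ ⌈ k /2⌉)) (cong (2 *_) (⌊n/2⌋+⌈n/2⌉≡n k))

≤-double-⌊/2⌋ : ∀ k → k ≤ suc (2 * ⌊ k /2⌋)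
≤-double-⌊/2⌋ zero = z≤n
≤-double-⌊/2⌋ (suc zero) = s≤s z≤n
≤-double-⌊/2⌋ (suc (suc k)) = s≤s (s≤s (subst (k ≤_) (sym (+-suc ⌊ k /2⌋ _)) (≤-double-⌊/2⌋ k)))

≤-double-⌈/2⌉ : ∀ k → k ≤ 2 * ⌈ k /2⌉
≤-double-⌈/2⌉ k = begin
  k                       ≡⟨ ⌊n/2⌋+⌈n/2⌉≡n k ⟨
  ⌊ k /2⌋ + ⌈ k /2⌉       ≤⟨ +-monoˡ-≤ ⌈ k /2⌉ (⌊n/2⌋≤⌈n/2⌉ k) ⟩
  ⌈ k /2⌉ + ⌈ k /2⌉       ≡⟨ double ⌈ k /2⌉ ⟨
  2 * ⌈ k /2⌉             ∎
  where open ≤-Reasoning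

triple-⌈/2⌉ : ∀ n → 3 * ⌈ 2 + n /2⌉ ≤ 2 * (2 + n)
triple-⌈/2⌉ zero = s≤s (s≤s (s≤s z≤n))
triple-⌈/2⌉ (suc zero) = ≤-refl
triple-⌈/2⌉ (suc (suc n)) =
  ≤-trans (≤-reflexive (*-suc 3 ⌈ 2 + n /2⌉))
    (≤-trans (+-mono-≤ (n≤1+n 3) (triple-⌈/2⌉ n)) (≤-reflexive (sym (*-distribˡ-+ 2 2 (2 + n)))))

triples-fit : ∀ {r} k → 3 ≤ r → 2 * k ≤ r → 3 * ⌈ k /2⌉ ≤ r
triples-fit zero 3≤r _ = z≤n
triples-fit (suc zero) 3≤r _ = 3≤r
triples-fit (suc (suc k)) _ 2k≤r = ≤-trans (triple-⌈/2⌉ k) 2k≤r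

counts-contradict : ∀ {s e t x y oa ob} → oa + x ≡ 2 * e → ob + y ≡ 2 * t →
  s ≤ 2 * e → s < e + t → s < 2 * t →
  t + oa ≤ s → e ⊓ y + t ⊓ x ≤ s → e ⊓ y + ob ≤ s → ⊥
counts-contradict {s} {e} {t} {x} {y} {oa} {ob} splitA splitB s≤2e s<e+t s<2t boundI boundII boundIII
  with x <? t | e ≤? y
... | yes x<t | _ = <-irrefl refl (begin-strict
      t + oa   ≤⟨ boundI ⟩
      s        ≤⟨ s≤2e ⟩
      2 * e    ≡⟨ splitA ⟨
      oa + x   <⟨ +-monoʳ-< oa x<t ⟩
      oa + t   ≡⟨ +-comm oa t ⟩
      t + oa   ∎)
  where open ≤-Reasoning
... | no x≮t | yes e≤y = <-irrefl refl (begin-strict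
      e + t           ≡⟨ cong₂ _+_ (m≤n⇒m⊓n≡m e≤y) (m≤n⇒m⊓n≡m (≮⇒≥ x≮t)) ⟨
      e ⊓ y + t ⊓ x   ≤⟨ boundII ⟩
      s               <⟨ s<e+t ⟩
      e + t           ∎)
  where open ≤-Reasoning
... | no _ | no e≰y = <-irrefl refl (begin-strict
      ob + y          ≡⟨ +-comm ob y ⟩
      y + ob          ≡⟨ cong (_+ ob) (m≥n⇒m⊓n≡n (<⇒≤ (≰⇒> e≰y))) ⟨
      e ⊓ y + ob      ≤⟨ boundIII ⟩
      s               <⟨ s<2t ⟩
      2 * t           ≡⟨ splitB ⟨
      ob + y          ∎)
  where open ≤-Reasoning

module Argument (r a b k s : ℕ) (3≤r : 3 ≤ r) (r≤a : r ≤ a) (r≤b : r ≤ b)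
                (2k≤r : 2 * k ≤ r) (s<k : s < k) where

  open Bipartite a b
  open GraphGame (KV a b) (KAdj a b) _≟V_ adj? 3 r s
  open import Data.List.Membership.DecPropositional (_≟ᶠ_ {r}) using (_∈?_)

  e t : ℕ
  e = ⌊ k /2⌋
  t = ⌈ k /2⌉

  homeA homeB : Fin r → KV a b
  homeA i = inj₁ (inject≤ i r≤a)
  homeB i = inj₂ (inject≤ i r≤b)

  unique-homesA : ∀ {cs} → Unique cs → Unique (map homeA cs)
  unique-homesA = Unique.map⁺ λ eq → inject≤-injective r≤a r≤a _ _ (inj₁-injective eq)

  unique-homesB : ∀ {cs} → Unique cs → Unique (map homeB cs)
  unique-homesB = Unique.map⁺ λ eq → inject≤-injective r≤b r≤b _ _ (inj₂-injective eq)

  homeA-occupied? : (S : SConf) → Decidable (λ i → Occupied S (homeA i))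
  homeA-occupied? S i = occupied? S (homeA i)

  homeB-occupied? : (S : SConf) → Decidable (λ i → Occupied S (homeB i))
  homeB-occupied? S i = occupied? S (homeB i)

  sideB-occupied? : (S : SConf) → Decidable (λ w → Occupied S (inj₂ w))
  sideB-occupied? S w = occupied? S (inj₂ w)

  -- Nobody moves (used once a play has served its purpose).
  stay : Plan
  stay _ = nothing

  freeOnB : SConf → List (Fin b)
  freeOnB S = filter (¬? ∘ sideB-occupied? S) (allFin b)

  threatTargets : SConf → List (KV a b)
  threatTargets S = map inj₂ (take t (freeOnB S))

  threat : RevStrategy
  threat = planned homeA λ { [] S → groups 3 (allFin r) (threatTargets S) ; (_ ∷ _) _ → stay }

  squad : List (Fin r)
  squad = take (2 * k) (allFin r)

  free₀ occ₀ : SConf → List (Fin r)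
  free₀ S = filter (¬? ∘ homeA-occupied? S) squad
  occ₀  S = filter (homeA-occupied? S) squad

  holders crossers : SConf → List (Fin r)
  holders  S = take (2 * e) (free₀ S)
  crossers S = drop (2 * e) (free₀ S) ++ occ₀ S

  cross : SConf → Plan
  cross S i with i ∈? crossers S
  ... | yes _ = just (homeB i)
  ... | no  _ = nothing

  openA blockedA openB blockedB : SConf → SConf → List (Fin r)
  openA    S S' = filter (¬? ∘ homeA-occupied? S') (holders S)
  blockedA S S' = filter (homeA-occupied? S') (holders S)
  openB    S S' = filter (¬? ∘ homeB-occupied? S') (crossers S)
  blockedB S S' = filter (homeB-occupied? S') (crossers S)

  targetsA targetsB : SConf → SConf → List (KV a b)
  targetsA S S' = map homeA (take t (openA S S'))
  targetsB S S' = map homeB (take e (openB S S'))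

  strikeA strikeB : SConf → SConf → Plan
  strikeA S S' = groups 2 (crossers S) (targetsA S S')
  strikeB S S' = groups 2 (holders S) (targetsB S S')

  twoRounds : (SConf → SConf → Plan) → RevStrategy
  twoRounds strike = planned homeA λ
    { [] S → cross S ; ((_ , S) ∷ []) S' → strike S S' ; (_ ∷ _ ∷ _) _ → stay }

  -- The threat finds t free vertices on side B: at most s of the b ≥ s + t are occupied.
  length-threatTargets : ∀ S → length (threatTargets S) ≡ t
  length-threatTargets S = trans (length-map inj₂ (take t (freeOnB S))) (length-take-≤ t (freeOnB S) room)
    where
    occOnB : List (Fin b)
    occOnB = filter (sideB-occupied? S) (allFin b)
    occupied : ∀ {v} → v ∈ map inj₂ occOnB → Occupied S v
    occupied v∈ with ∈-map⁻ inj₂ v∈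
    ... | w , w∈ , refl = proj₂ (∈-filter⁻ (sideB-occupied? S) {xs = allFin b} w∈)
    few-occupied : length occOnB ≤ s
    few-occupied = subst (_≤ s) (length-map inj₂ occOnB)
      (occupied-bound S (Unique.map⁺ inj₂-injective (Unique.filter⁺ (sideB-occupied? S) (Unique.allFin⁺ b))) occupied)
    t+s≤b : t + s ≤ length occOnB + length (freeOnB S)
    t+s≤b = begin
      t + s     ≤⟨ +-mono-≤ (⌈n/2⌉≤n k) (<⇒≤ s<k) ⟩
      k + k     ≡⟨ double k ⟨
      2 * k     ≤⟨ ≤-trans 2k≤r r≤b ⟩
      b         ≡⟨ trans (length-filter-split (sideB-occupied? S) (allFin b)) (length-tabulate (λ w → w)) ⟨
      length occOnB + length (freeOnB S) ∎
      where open ≤-Reasoning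
    room : t ≤ length (freeOnB S)
    room = trade t+s≤b few-occupied

  unique-threatTargets : ∀ S → Unique (threatTargets S)
  unique-threatTargets S =
    Unique.map⁺ inj₂-injective (Unique.take⁺ t (Unique.filter⁺ (¬? ∘ sideB-occupied? S) (Unique.allFin⁺ b)))

  unique-squad : Unique squad
  unique-squad = Unique.take⁺ (2 * k) (Unique.allFin⁺ r)

  length-squad : length squad ≡ 2 * k
  length-squad = length-take-≤ (2 * k) (allFin r) (subst (2 * k ≤_) (sym (length-tabulate (λ i → i))) 2k≤r)

  unique-free₀ : ∀ S → Unique (free₀ S)
  unique-free₀ S = Unique.filter⁺ (¬? ∘ homeA-occupied? S) unique-squad

  holders-free : ∀ {S c} → c ∈ holders S → ¬ Occupied S (homeA c)
  holders-free {S} c∈ = proj₂ (∈-filter⁻ (¬? ∘ homeA-occupied? S) {xs = squad} (∈-take (2 * e) c∈))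

  occ₀-occupied : ∀ {S c} → c ∈ occ₀ S → Occupied S (homeA c)
  occ₀-occupied {S} c∈ = proj₂ (∈-filter⁻ (homeA-occupied? S) {xs = squad} c∈)

  holder-not-crosser : ∀ {S c} → c ∈ holders S → c ∉ crossers S
  holder-not-crosser {S} c∈ c∈′ with ∈-++⁻ (drop (2 * e) (free₀ S)) c∈′
  ... | inj₁ c∈rest = take-drop-disjoint (2 * e) (unique-free₀ S) c∈ c∈rest
  ... | inj₂ c∈occ  = holders-free c∈ (occ₀-occupied c∈occ)

  unique-holders : ∀ S → Unique (holders S)
  unique-holders S = Unique.take⁺ (2 * e) (unique-free₀ S)

  unique-crossers : ∀ S → Unique (crossers S)
  unique-crossers S =
    Unique.++⁺ (Unique.drop⁺ (2 * e) (unique-free₀ S)) (Unique.filter⁺ (homeA-occupied? S) unique-squad) disjoint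
    where
    disjoint : ∀ {c} → ¬ (c ∈ drop (2 * e) (free₀ S) × c ∈ occ₀ S)
    disjoint (c∈rest , c∈occ) =
      proj₂ (∈-filter⁻ (¬? ∘ homeA-occupied? S) {xs = squad} (∈-drop (2 * e) c∈rest)) (occ₀-occupied c∈occ)

  length-occ₀ : ∀ S → length (occ₀ S) ≤ s
  length-occ₀ S = subst (_≤ s) (length-map homeA (occ₀ S))
    (occupied-bound S (unique-homesA (Unique.filter⁺ (homeA-occupied? S) unique-squad)) occupied)
    where
    occupied : ∀ {v} → v ∈ map homeA (occ₀ S) → Occupied S v
    occupied v∈ with ∈-map⁻ homeA v∈
    ... | c , c∈ , refl = occ₀-occupied c∈

  split-squad : ∀ S → length (occ₀ S) + length (free₀ S) ≡ 2 * e + 2 * t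
  split-squad S = trans (length-filter-split (homeA-occupied? S) squad) (trans length-squad (sym (halves k)))

  -- Since s < 2t, at least 2e squad members start on free vertices.
  enough-free : ∀ S → 2 * e ≤ length (free₀ S)
  enough-free S = trade (≤-reflexive (sym (split-squad S)))
                        (≤-trans (length-occ₀ S) (<⇒≤ (<-≤-trans s<k (≤-double-⌈/2⌉ k))))

  length-holders : ∀ S → length (holders S) ≡ 2 * e
  length-holders S = length-take-≤ (2 * e) (free₀ S) (enough-free S)

  length-crossers : ∀ S → length (crossers S) ≡ 2 * t
  length-crossers S = begin
    length (drop (2 * e) F ++ O)          ≡⟨ length-++ (drop (2 * e) F) ⟩
    length (drop (2 * e) F) + length O    ≡⟨ cong (_+ length O) (length-drop (2 * e) F) ⟩
    (length F ∸ 2 * e) + length O         ≡⟨ +-∸-comm (length O) (enough-free S) ⟨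
    (length F + length O) ∸ 2 * e         ≡⟨ cong (_∸ 2 * e) (trans (+-comm (length F) (length O)) (split-squad S)) ⟩
    (2 * e + 2 * t) ∸ 2 * e               ≡⟨ m+n∸m≡n (2 * e) (2 * t) ⟩
    2 * t                                 ∎
    where
    open ≡-Reasoning
    F O : List (Fin r)
    F = free₀ S
    O = occ₀ S

  holder-stays : ∀ {S c} → c ∈ holders S → execute (cross S) homeA c ≡ homeA c
  holder-stays {S} {c} c∈ with c ∈? crossers S
  ... | yes c∈′ = ⊥-elim (holder-not-crosser c∈ c∈′)
  ... | no  _   = refl

  crosser-crosses : ∀ {S n} → n ∈ crossers S → execute (cross S) homeA n ≡ homeB n
  crosser-crosses {S} {n} n∈ with n ∈? crossers S
  ... | yes _  = refl
  ... | no n∉ = ⊥-elim (n∉ n∈)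

  crosser-reaches-A : ∀ {S n v cs} → n ∈ crossers S → v ∈ map homeA cs →
                      KAdj a b (execute (cross S) homeA n) v
  crosser-reaches-A n∈ v∈ with ∈-map⁻ homeA v∈
  ... | c , _ , refl = subst (λ x → KAdj a b x (homeA c)) (sym (crosser-crosses n∈)) tt

  holder-reaches-B : ∀ {S c v cs} → c ∈ holders S → v ∈ map homeB cs →
                     KAdj a b (execute (cross S) homeA c) v
  holder-reaches-B c∈ v∈ with ∈-map⁻ homeB v∈
  ... | n , _ , refl = subst (λ x → KAdj a b x (homeB n)) (sym (holder-stays c∈)) tt

  pairs-fit : ∀ n (f : Fin r → KV a b) (xs ms : List (Fin r)) → length ms ≡ 2 * n →
              2 * length (map f (take n xs)) ≤ length ms
  pairs-fit n f xs ms len = begin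
    2 * length (map f (take n xs))   ≡⟨ cong (2 *_) (length-targets f n xs) ⟩
    2 * (n ⊓ length xs)              ≤⟨ *-monoʳ-≤ 2 (m⊓n≤m n (length xs)) ⟩
    2 * n                            ≡⟨ len ⟨
    length ms                        ∎
    where open ≤-Reasoning

  unique-targetsA : ∀ S S' → Unique (targetsA S S')
  unique-targetsA S S' =
    unique-homesA (Unique.take⁺ t (Unique.filter⁺ (¬? ∘ homeA-occupied? S') (unique-holders S)))

  unique-targetsB : ∀ S S' → Unique (targetsB S S')
  unique-targetsB S S' =
    unique-homesB (Unique.take⁺ e (Unique.filter⁺ (¬? ∘ homeB-occupied? S') (unique-crossers S)))

  -- All strategies
  -- used below start from homeA, and those of the real play agree in round 1, so
  -- σ produces the same positions S₀ and S₁ in all of them.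
  module _ (σ : SpyStrategy) (σ-wins : ∀ τ n → ¬ RevWinsAt (proj₂ (play τ σ n))) where

    reply : List Pos → RConf → (S : SConf) → Plan → Σ SConf (Moves S)
    reply past R S p = SpyStrategy.respond σ past R S (execute p R) (λ i → toward-step (R i) (p i))

    S₀ : SConf
    S₀ = SpyStrategy.place σ homeA

    R₁ : RConf
    R₁ = execute (cross S₀) homeA

    Sᵀ S₁ S₂ᴬ S₂ᴮ : SConf
    Sᵀ  = proj₁ (reply [] homeA S₀ (groups 3 (allFin r) (threatTargets S₀)))
    S₁  = proj₁ (reply [] homeA S₀ (cross S₀))
    S₂ᴬ = proj₁ (reply ((homeA , S₀) ∷ []) R₁ S₁ (strikeA S₀ S₁))
    S₂ᴮ = proj₁ (reply ((homeA , S₀) ∷ []) R₁ S₁ (strikeB S₀ S₁))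

    threat-spies : ∀ {v} → v ∈ threatTargets S₀ → ∃[ j ] Sᵀ j ≡ v × OnA (S₀ j)
    threat-spies v∈ with ∈-map⁻ inj₂ v∈
    ... | w , w∈ , refl
      with attack 3 (allFin r) (threatTargets S₀) {homeA} (Unique.allFin⁺ r) triples (λ _ → reach)
             (proj₂ (reply [] homeA S₀ (groups 3 (allFin r) (threatTargets S₀)))) (σ-wins threat 1) v∈
             (proj₂ (∈-filter⁻ (¬? ∘ sideB-occupied? S₀) {xs = allFin b} (∈-take t w∈))) [] [] ≤-refl [] []
      where
      triples : 3 * length (threatTargets S₀) ≤ length (allFin r)
      triples = subst₂ _≤_ (cong (3 *_) (sym (length-threatTargets S₀))) (sym (length-tabulate (λ i → i)))
                  (triples-fit k 3≤r 2k≤r)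
      reach : ∀ {i v} → v ∈ threatTargets S₀ → KAdj a b (homeA i) v
      reach v∈′ with ∈-map⁻ inj₂ v∈′
      ... | _ , _ , refl = tt
    ... | j , at , adj = j , at , into-B adj

    blockedA-spies : ∀ {v} → v ∈ map homeA (blockedA S₀ S₁) → ∃[ j ] S₁ j ≡ v × ¬ OnA (S₀ j)
    blockedA-spies v∈ with ∈-map⁻ homeA v∈
    ... | c , c∈ , refl with ∈-filter⁻ (homeA-occupied? S₁) {xs = holders S₀} c∈
    ... | c∈holders , occupied
      with arrival (proj₂ (reply [] homeA S₀ (cross S₀))) (holders-free c∈holders) occupied
    ... | j , at , adj = j , at , into-A adj

    blockedB-spies : ∀ {v} → v ∈ map homeB (blockedB S₀ S₁) → ∃[ j ] S₁ j ≡ v × ¬ OnA (S₁ j)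
    blockedB-spies v∈ with ∈-map⁻ homeB v∈
    ... | n , n∈ , refl with ∈-filter⁻ (homeB-occupied? S₁) {xs = crossers S₀} n∈
    ... | _ , (j , at) = j , at , subst (¬_ ∘ OnA) (sym at) λ ()

    strikeA-spies : ∀ {v} → v ∈ targetsA S₀ S₁ → ∃[ j ] S₂ᴬ j ≡ v × ¬ OnA (S₁ j)
    strikeA-spies v∈ with ∈-map⁻ homeA v∈
    ... | c , c∈ , refl with ∈-filter⁻ (¬? ∘ homeA-occupied? S₁) {xs = holders S₀} (∈-take t c∈)
    ... | c∈holders , free
      with attack 2 (crossers S₀) (targetsA S₀ S₁) {R₁} (unique-crossers S₀)
             (pairs-fit t homeA (openA S₀ S₁) (crossers S₀) (length-crossers S₀)) crosser-reaches-A
             (proj₂ (reply ((homeA , S₀) ∷ []) R₁ S₁ (strikeA S₀ S₁))) (σ-wins (twoRounds strikeA) 2) v∈ free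
             [ c ] ([] ∷ []) ≤-refl (holder-stays c∈holders ∷ []) (holder-not-crosser c∈holders ∷ [])
    ... | j , at , adj = j , at , into-A adj

    strikeB-spies : ∀ {v} → v ∈ targetsB S₀ S₁ → ∃[ j ] S₂ᴮ j ≡ v × OnA (S₁ j)
    strikeB-spies v∈ with ∈-map⁻ homeB v∈
    ... | n , n∈ , refl with ∈-filter⁻ (¬? ∘ homeB-occupied? S₁) {xs = crossers S₀} (∈-take e n∈)
    ... | n∈crossers , free
      with attack 2 (holders S₀) (targetsB S₀ S₁) {R₁} (unique-holders S₀)
             (pairs-fit e homeB (openB S₀ S₁) (holders S₀) (length-holders S₀)) holder-reaches-B
             (proj₂ (reply ((homeA , S₀) ∷ []) R₁ S₁ (strikeB S₀ S₁))) (σ-wins (twoRounds strikeB) 2) v∈ free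
             [ n ] ([] ∷ []) ≤-refl (crosser-crosses n∈crossers ∷ []) (not-holder ∷ [])
      where
      not-holder : n ∉ holders S₀
      not-holder n∈holders = holder-not-crosser n∈holders n∈crossers
    ... | j , at , adj = j , at , into-B adj

    bound-threat : t + length (blockedA S₀ S₁) ≤ s
    bound-threat = subst₂ (λ x y → x + y ≤ s) (length-threatTargets S₀) (length-map homeA (blockedA S₀ S₁))
      (spy-bound (OnA ∘ S₀) (unique-threatTargets S₀)
        (unique-homesA (Unique.filter⁺ (homeA-occupied? S₁) (unique-holders S₀)))
        threat-spies blockedA-spies)

    bound-strikes : e ⊓ length (openB S₀ S₁) + t ⊓ length (openA S₀ S₁) ≤ s
    bound-strikes = subst₂ (λ x y → x + y ≤ s) (length-targets homeB e (openB S₀ S₁))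
                      (length-targets homeA t (openA S₀ S₁))
      (spy-bound (OnA ∘ S₁) (unique-targetsB S₀ S₁) (unique-targetsA S₀ S₁) strikeB-spies strikeA-spies)

    bound-crossers : e ⊓ length (openB S₀ S₁) + length (blockedB S₀ S₁) ≤ s
    bound-crossers = subst₂ (λ x y → x + y ≤ s) (length-targets homeB e (openB S₀ S₁))
                       (length-map homeB (blockedB S₀ S₁))
      (spy-bound (OnA ∘ S₁) (unique-targetsB S₀ S₁)
        (unique-homesB (Unique.filter⁺ (homeB-occupied? S₁) (unique-crossers S₀)))
        strikeB-spies blockedB-spies)

    splitA : length (blockedA S₀ S₁) + length (openA S₀ S₁) ≡ 2 * e
    splitA = trans (length-filter-split (homeA-occupied? S₁) (holders S₀)) (length-holders S₀)

    splitB : length (blockedB S₀ S₁) + length (openB S₀ S₁) ≡ 2 * t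
    splitB = trans (length-filter-split (homeB-occupied? S₁) (crossers S₀)) (length-crossers S₀)

    impossible : ⊥
    impossible = counts-contradict {s} {e} {t} {length (openA S₀ S₁)} {length (openB S₀ S₁)}
                   {length (blockedA S₀ S₁)} {length (blockedB S₀ S₁)} splitA splitB
      (≤-pred (≤-trans s<k (≤-double-⌊/2⌋ k)))
      (subst (s <_) (sym (⌊n/2⌋+⌈n/2⌉≡n k)) s<k)
      (<-≤-trans s<k (≤-double-⌈/2⌉ k))
      bound-threat bound-strikes bound-crossers

  spies-lose : ¬ SpiesWin
  spies-lose (σ , σ-wins) = impossible σ σ-wins

theorem7p3 : (r a b : ℕ) → 3 ≤ r → RLarge r a b →
    σ≥ (KV a b) (KAdj a b) 3 r (r / 2)
theorem7p3 r a b 3≤r (2r≤a , 2r≤b) s s<r/2 =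
  Argument.spies-lose r a b (r / 2) s 3≤r (≤-trans r≤2r 2r≤a) (≤-trans r≤2r 2r≤b) 2k≤r s<r/2
  where
  r≤2r : r ≤ 2 * r
  r≤2r = m≤n*m r 2
  2k≤r : 2 * (r / 2) ≤ r
  2k≤r = subst (_≤ r) (*-comm (r / 2) 2) (m/n*n≤m r 2)
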